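{- Let $G$ be a finite group with $d(G)=3$. Then one of the following holds: (i) $G$ is generalized dihedral; (ii) $G$ is abelian and admits a generating set $\{a,b,c\}$ with $|a|,|b|,|c|,|ba^{ -1}|,|cb^{ -1}|>2$; (iii) every generating set $\{a,b,c\}$ of $G$ with $|a|,|b|,|c|>2$ has $|ab|=|ab^{ -1}|=|bc|=|bc^{ -1}|=|ac|=|ac^{ -1}|=2$; (iv) $G$ admits a generating set $\{a,b,c\}$ with $|a|,|b|,|c|>2$, $|ab|=|ab^{ -1}|=|bc|=|bc^{ -1}|=2$, $|ac^{ -1}|>2$ and $[a,c]\neq 1$; (v) $G$ admits a generating set $\{a,b,c\}$ with $|a|,|b|,|c|>2$, $|ab|=|ab^{ -1}|=|bc|=|bc^{ -1}|=2$, $|ac^{ -1}|>2$ and $[a,c]=1$; (vi) $G$ admits a generating set $\{a,b,c\}$ with $|a|,|b|,|c|,|ba^{ -1}|,|cb^{ -1}|>2$ and $[a,b]\ne 1$.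
   Context: $d(G)$ is the minimum cardinality of a generating set of $G$; $|g|$ is the order; $[a,b]$ is the commutator. $G$ is generalized dihedral if it contains an abelian subgroup $A$ of index $2$ and $\tau\in G\setminus A$ with $\tau^2=1$ and $\tau a\tau=a^{ -1}$ for all $a\in A$. -}

module Defs where

open import Level using (Level; _⊔_) renaming (suc to lsuc)
open import Algebra.Bundles using (Group)
open import Data.Nat using (ℕ; zero; suc; _<_)
open import Data.Fin using (Fin)
open import Data.List using (List; length; _∷_; [])
open import Data.List.Membership.Propositional using (_∈_)
open import Data.Product using (Σ; ∃; _×_; _,_)
open import Data.Sum using (_⊎_)
open import Relation.Nullary using (¬_)
open import Relation.Binary.PropositionalEquality using (_≡_)

module _ {c ℓ : Level} (G : Group c ℓ) where
  open Group G

  IsFinite : Set (c ⊔ ℓ)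
  IsFinite = Σ ℕ λ n → Σ (Fin n → Carrier) λ f →
               (∀ x → ∃ λ i → f i ≈ x) × (∀ i j → f i ≈ f j → i ≡ j)

  pow : Carrier → ℕ → Carrier
  pow g zero    = ε
  pow g (suc k) = g ∙ pow g k

  HasOrder : Carrier → ℕ → Set ℓ
  HasOrder g n = 0 < n × pow g n ≈ ε × (∀ k → 0 < k → k < n → ¬ (pow g k ≈ ε))

  OrderGt2 : Carrier → Set ℓ
  OrderGt2 g = ∃ λ n → HasOrder g n × 2 < n

  Order2 : Carrier → Set ℓ
  Order2 g = HasOrder g 2

  comm : Carrier → Carrier → Carrier
  comm a b = ((a ⁻¹ ∙ b ⁻¹) ∙ a) ∙ b

  data InSpan (S : List Carrier) : Carrier → Set (c ⊔ ℓ) where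
    gen  : ∀ {x} → x ∈ S → InSpan S x
    one  : InSpan S ε
    mul  : ∀ {x y} → InSpan S x → InSpan S y → InSpan S (x ∙ y)
    inv  : ∀ {x} → InSpan S x → InSpan S (x ⁻¹)
    resp : ∀ {x y} → x ≈ y → InSpan S x → InSpan S y

  Generates : List Carrier → Set (c ⊔ ℓ)
  Generates S = ∀ x → InSpan S x

  RankIs : ℕ → Set (c ⊔ ℓ)
  RankIs n = (∃ λ S → length S ≡ n × Generates S)
           × (∀ S → length S < n → ¬ Generates S)

  GenTriple : Carrier → Carrier → Carrier → Set (c ⊔ ℓ)
  GenTriple a b d = Generates (a ∷ b ∷ d ∷ [])

  record IsSubgroup (A : Carrier → Set (c ⊔ ℓ)) : Set (c ⊔ ℓ) where
    field
      A-resp : ∀ {x y} → x ≈ y → A x → A y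
      A-ε    : A ε
      A-∙    : ∀ {x y} → A x → A y → A (x ∙ y)
      A-⁻¹   : ∀ {x} → A x → A (x ⁻¹)

  -- A has index 2: there is t ∉ A such that the left cosets are exactly A and tA
  Index2 : (Carrier → Set (c ⊔ ℓ)) → Set (c ⊔ ℓ)
  Index2 A = ∃ λ t → ¬ A t × (∀ x → A x ⊎ A (t ⁻¹ ∙ x))

  GeneralizedDihedral : Set (lsuc (c ⊔ ℓ))
  GeneralizedDihedral =
    Σ (Carrier → Set (c ⊔ ℓ)) λ A →
      IsSubgroup A × (∀ x y → A x → A y → x ∙ y ≈ y ∙ x) × Index2 A ×
      (∃ λ τ → ¬ A τ × τ ∙ τ ≈ ε × (∀ a → A a → (τ ∙ a) ∙ τ ≈ a ⁻¹))

  IsAbelian : Set (c ⊔ ℓ)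
  IsAbelian = ∀ x y → x ∙ y ≈ y ∙ x

  Case2 : Set (c ⊔ ℓ)
  Case2 = IsAbelian × (∃ λ a → ∃ λ b → ∃ λ d → GenTriple a b d ×
            OrderGt2 a × OrderGt2 b × OrderGt2 d ×
            OrderGt2 (b ∙ a ⁻¹) × OrderGt2 (d ∙ b ⁻¹))

  Case3 : Set (c ⊔ ℓ)
  Case3 = ∀ a b d → GenTriple a b d → OrderGt2 a → OrderGt2 b → OrderGt2 d →
            Order2 (a ∙ b) × Order2 (a ∙ b ⁻¹) × Order2 (b ∙ d) ×
            Order2 (b ∙ d ⁻¹) × Order2 (a ∙ d) × Order2 (a ∙ d ⁻¹)

  Case45Core : Carrier → Carrier → Carrier → Set (c ⊔ ℓ)
  Case45Core a b d = GenTriple a b d ×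
            OrderGt2 a × OrderGt2 b × OrderGt2 d ×
            Order2 (a ∙ b) × Order2 (a ∙ b ⁻¹) × Order2 (b ∙ d) ×
            Order2 (b ∙ d ⁻¹) × OrderGt2 (a ∙ d ⁻¹)

  Case4 : Set (c ⊔ ℓ)
  Case4 = ∃ λ a → ∃ λ b → ∃ λ d → Case45Core a b d × ¬ (comm a d ≈ ε)

  Case5 : Set (c ⊔ ℓ)
  Case5 = ∃ λ a → ∃ λ b → ∃ λ d → Case45Core a b d × comm a d ≈ ε

  Case6 : Set (c ⊔ ℓ)
  Case6 = ∃ λ a → ∃ λ b → ∃ λ d → GenTriple a b d ×
            OrderGt2 a × OrderGt2 b × OrderGt2 d ×
            OrderGt2 (b ∙ a ⁻¹) × OrderGt2 (d ∙ b ⁻¹) × ¬ (comm a b ≈ ε)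

module Submission where

-- Constructively the only difficulty is that (iii) is a universal statement;
-- in a finite group equality, orders and generation are decidable, so we can
-- search all triples for a *bad* one: a generating triple {a,b,d} of elements
-- of order > 2 for which one of the six products in (iii) is not an
-- involution.  If there is none, (iii) holds.  Otherwise that product is big,
-- giving a triple with |ba⁻¹| > 2 (Chain₁); either it extends to one with also
-- |db⁻¹| > 2 (Chain₂) or the remaining products are involutions, which is
-- (iv)/(v).  From a Chain₂, commutation decides between (ii) and (vi); the one
-- leftover configuration is excluded by a computation with involutions
-- (commute-from-involutions).

open import Defs
open import Level using (Level; _⊔_) renaming (suc to lsuc)
open import Algebra.Bundles using (Group)
open import Data.Nat as ℕ using (ℕ; zero; suc; _+_; _∸_; z≤n; s≤s)
import Data.Nat.Properties as ℕP
open import Data.Fin using (Fin; toℕ)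
import Data.Fin.Properties as FP
open import Data.Fin.Subset using (Subset; _⊂_; ∣_∣) renaming (_∈_ to _∈ₛ_)
open import Data.Fin.Subset.Properties using (p⊂q⇒∣p∣<∣q∣; ∣p∣≤n)
open import Data.Vec using (tabulate)
open import Data.Vec.Properties using (lookup∘tabulate; lookup⇒[]=; []=⇒lookup)
open import Data.Bool.Properties using (T-≡)
open import Data.List using (List; []; _∷_; length; lookup)
open import Data.List.Membership.Propositional using (_∈_)
open import Data.List.Membership.Propositional.Properties using (∈-lookup)
open import Data.List.Relation.Unary.Any as Any using (here; there)
open import Data.List.Relation.Unary.Any.Properties using (lookup-index)
open import Data.List.Relation.Unary.All as All using (All; []; _∷_)
open import Data.Product using (∃; _×_; _,_; proj₁; proj₂; uncurry)
open import Data.Sum using (_⊎_; inj₁; inj₂; [_,_]′)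
open import Data.Empty using (⊥-elim)
open import Function using (_∘_)
open import Function.Bundles using (Equivalence)
open import Relation.Nullary using (¬_; Dec; yes; no; does)
open import Relation.Nullary.Decidable
  using (_×-dec_; _⊎-dec_; _→-dec_; ¬?; map′; dec-true; isYes≗does; toWitness; decidable-stable)
open import Relation.Unary using (Decidable)
open import Relation.Binary.PropositionalEquality as P using (_≡_)

module _ {p} {Q : ℕ → Set p} (Q? : ∀ k → Dec (Q k)) where

  least-or-none : ∀ m → (∃ λ j → Q j × (∀ i → i ℕ.< j → ¬ Q i)) ⊎ (∀ j → j ℕ.< m → ¬ Q j)
  least-or-none zero = inj₂ λ j ()
  least-or-none (suc m) with least-or-none m
  ... | inj₁ least = inj₁ least
  ... | inj₂ none with Q? m
  ...   | yes q = inj₁ (m , q , none)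
  ...   | no ¬q = inj₂ λ j j<1+m → [ none j , (λ { P.refl → ¬q }) ]′ (ℕP.m<1+n⇒m<n∨m≡n j<1+m)

  leastWitness : ∀ {m} → Q m → ∃ λ j → Q j × (∀ i → i ℕ.< j → ¬ Q i)
  leastWitness {m} qm = [ (λ least → least) , (λ none → ⊥-elim (none m (ℕP.n<1+n m) qm)) ]′
                          (least-or-none (suc m))

-- This is what makes the subgroup generated by a list decidable.
module Stabilisation {n p} (P : ℕ → Fin n → Set p) (P? : ∀ k → Decidable (P k))
                     (grow : ∀ {k i} → P k i → P (suc k) i) where

  Stable : ℕ → Set p
  Stable k = ∀ i → P (suc k) i → P k i

  -- P k as a subset, so that library cardinality bounds apply
  set : ℕ → Subset n
  set k = tabulate (does ∘ P? k)

  set⁺ : ∀ {k i} → P k i → i ∈ₛ set k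
  set⁺ {k} {i} x = lookup⇒[]= i (set k) (P.trans (lookup∘tabulate _ i) (dec-true (P? k i) x))

  set⁻ : ∀ {k i} → i ∈ₛ set k → P k i
  set⁻ {k} {i} mem =
    toWitness {a? = P? k i} (Equivalence.from T-≡
      (P.trans (isYes≗does (P? k i)) (P.trans (P.sym (lookup∘tabulate _ i)) ([]=⇒lookup mem))))

  grows-strictly : ∀ k → ¬ Stable k → set k ⊂ set (suc k)
  grows-strictly k unstable with FP.¬∀⟶∃¬ n _ (λ i → P? (suc k) i →-dec P? k i) unstable
  ... | i , ¬step = set⁺ ∘ grow ∘ set⁻ , i , set⁺ new , old ∘ set⁻
    where
      new : P (suc k) i
      new = decidable-stable (P? (suc k) i) λ ¬new → ¬step λ x → ⊥-elim (¬new x)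
      old : ¬ P k i
      old x = ¬step λ _ → x

  climb : ∀ f k → k ℕ.≤ ∣ set k ∣ → n ℕ.< k + f → ∃ Stable
  climb zero k k≤ n< =
    ⊥-elim (ℕP.<-irrefl P.refl (ℕP.<-≤-trans (P.subst (n ℕ.<_) (ℕP.+-identityʳ k) n<)
                                              (ℕP.≤-trans k≤ (∣p∣≤n (set k)))))
  climb (suc f) k k≤ n< with FP.all? (λ i → P? (suc k) i →-dec P? k i)
  ... | yes stable = k , stable
  ... | no unstable = climb f (suc k) (ℕP.≤-<-trans k≤ (p⊂q⇒∣p∣<∣q∣ (grows-strictly k unstable)))
                                      (P.subst (n ℕ.<_) (ℕP.+-suc k f) n<)

  stabilises : ∃ Stable
  stabilises = climb (suc n) 0 z≤n (ℕP.n<1+n n)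

module GroupFacts {c ℓ} (G : Group c ℓ) where
  open Group G
  open import Algebra.Properties.Group G
  open import Relation.Binary.Reasoning.Setoid setoid

  quotient-⁻¹ : ∀ x y → (x ∙ y ⁻¹) ⁻¹ ≈ y ∙ x ⁻¹
  quotient-⁻¹ x y = trans (⁻¹-anti-homo-∙ x (y ⁻¹)) (∙-congʳ (⁻¹-involutive y))

  rotate-trivial : ∀ {x y} → x ∙ y ≈ ε → y ∙ x ≈ ε
  rotate-trivial {x} {y} q = trans (∙-congʳ (inverseʳ-unique x y q)) (inverseˡ x)

  inverse-trivial : ∀ {x} → x ⁻¹ ≈ ε → x ≈ ε
  inverse-trivial q = ⁻¹-injective (trans q (sym ε⁻¹≈ε))

  Commute : Carrier → Carrier → Set ℓ
  Commute x y = x ∙ y ≈ y ∙ x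

  commute-ε : ∀ x → Commute x ε
  commute-ε x = trans (identityʳ x) (sym (identityˡ x))

  commute-∙ : ∀ {x y z} → Commute x y → Commute x z → Commute x (y ∙ z)
  commute-∙ {x} {y} {z} p q = begin
    x ∙ (y ∙ z) ≈⟨ sym (assoc _ _ _) ⟩
    (x ∙ y) ∙ z ≈⟨ ∙-congʳ p ⟩
    (y ∙ x) ∙ z ≈⟨ assoc _ _ _ ⟩
    y ∙ (x ∙ z) ≈⟨ ∙-congˡ q ⟩
    y ∙ (z ∙ x) ≈⟨ sym (assoc _ _ _) ⟩
    (y ∙ z) ∙ x ∎

  commute-⁻¹ : ∀ {x y} → Commute x y → Commute x (y ⁻¹)
  commute-⁻¹ {x} {y} q = begin
    x ∙ y ⁻¹             ≈⟨ sym (\\-leftDividesʳ y _) ⟩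
    y ⁻¹ ∙ (y ∙ (x ∙ y ⁻¹)) ≈⟨ ∙-congˡ (sym (assoc _ _ _)) ⟩
    y ⁻¹ ∙ ((y ∙ x) ∙ y ⁻¹) ≈⟨ ∙-congˡ (∙-congʳ (sym q)) ⟩
    y ⁻¹ ∙ ((x ∙ y) ∙ y ⁻¹) ≈⟨ ∙-congˡ (//-rightDividesʳ y x) ⟩
    y ⁻¹ ∙ x ∎

  commute-resp : ∀ {x y y′} → y ≈ y′ → Commute x y → Commute x y′
  commute-resp q p = trans (∙-congˡ (sym q)) (trans p (∙-congʳ q))

  commutator-trivial : ∀ {a b} → comm G a b ≈ ε → Commute a b
  commutator-trivial {a} {b} q =
    trans (inverseʳ-unique _ _ (trans (sym comm≈) q)) (⁻¹-involutive (b ∙ a))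
    where
      comm≈ : comm G a b ≈ (b ∙ a) ⁻¹ ∙ (a ∙ b)
      comm≈ = trans (assoc _ _ _) (∙-congʳ (sym (⁻¹-anti-homo-∙ b a)))

  interchange : ∀ {x y z w} → Commute y z → (x ∙ y) ∙ (z ∙ w) ≈ (x ∙ z) ∙ (y ∙ w)
  interchange {x} {y} {z} {w} yz = begin
    (x ∙ y) ∙ (z ∙ w) ≈⟨ assoc _ _ _ ⟩
    x ∙ (y ∙ (z ∙ w)) ≈⟨ ∙-congˡ (sym (assoc _ _ _)) ⟩
    x ∙ ((y ∙ z) ∙ w) ≈⟨ ∙-congˡ (∙-congʳ yz) ⟩
    x ∙ ((z ∙ y) ∙ w) ≈⟨ ∙-congˡ (assoc _ _ _) ⟩
    x ∙ (z ∙ (y ∙ w)) ≈⟨ sym (assoc _ _ _) ⟩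
    (x ∙ z) ∙ (y ∙ w) ∎

  -- Involutions (elements with u² = 1, the identity included)

  Involution : Carrier → Set ℓ
  Involution u = u ∙ u ≈ ε

  involution-resp : ∀ {u v} → u ≈ v → Involution u → Involution v
  involution-resp q i = trans (∙-cong (sym q) (sym q)) i

  involution-⁻¹ : ∀ {u} → Involution u → Involution (u ⁻¹)
  involution-⁻¹ {u} i = trans (sym (⁻¹-anti-homo-∙ u u)) (trans (⁻¹-cong i) ε⁻¹≈ε)

  involution-swap : ∀ {x y} → Involution (x ∙ y ⁻¹) → Involution (y ∙ x ⁻¹)
  involution-swap {x} {y} i = involution-resp (quotient-⁻¹ x y) (involution-⁻¹ i)

  square-absorbed : ∀ {x y} → Commute x y → Involution (x ∙ y) → x ∙ (y ∙ y) ≈ x ⁻¹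
  square-absorbed {x} {y} xy i =
    inverseʳ-unique x _ (trans (sym (assoc x x (y ∙ y))) (trans (sym (interchange (sym xy))) i))

  -- The arithmetic core of the last case of the analysis: if b commutes with
  -- a and c and ab, ab⁻¹, cb, ac are involutions, then a and c commute.
  -- Indeed with B = b²: a B = a⁻¹ = a b⁻², so B² = 1, and c B = c⁻¹; hence
  -- ac = (ac)⁻¹ = c⁻¹ a⁻¹ = (c B)(a B) = c a B² = c a.
  commute-from-involutions : ∀ {a b c} → Commute a b → Commute c b →
    Involution (a ∙ b) → Involution (a ∙ b ⁻¹) → Involution (c ∙ b) → Involution (a ∙ c) →
    Commute a c
  commute-from-involutions {a} {b} {c} ab cb ab² ab⁻¹² cb² ac² = begin
    a ∙ c             ≈⟨ inverseˡ-unique _ _ ac² ⟩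
    (a ∙ c) ⁻¹        ≈⟨ ⁻¹-anti-homo-∙ a c ⟩
    c ⁻¹ ∙ a ⁻¹       ≈⟨ ∙-cong (sym (square-absorbed cb cb²)) (sym (square-absorbed ab ab²)) ⟩
    (c ∙ B) ∙ (a ∙ B) ≈⟨ interchange (sym (commute-∙ ab ab)) ⟩
    (c ∙ a) ∙ (B ∙ B) ≈⟨ ∙-congˡ B² ⟩
    (c ∙ a) ∙ ε       ≈⟨ identityʳ _ ⟩
    c ∙ a             ∎
    where
      B = b ∙ b
      B≈b⁻² : B ≈ b ⁻¹ ∙ b ⁻¹
      B≈b⁻² = ∙-cancelˡ a _ _
        (trans (square-absorbed ab ab²) (sym (square-absorbed (commute-⁻¹ ab) ab⁻¹²)))
      B² : B ∙ B ≈ ε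
      B² = trans (∙-congˡ (trans B≈b⁻² (sym (⁻¹-anti-homo-∙ b b)))) (inverseʳ B)

  -- Elements of order > 2, described without powers

  Big : Carrier → Set ℓ
  Big x = ¬ (x ≈ ε) × ¬ Involution x

  big-resp : ∀ {x y} → x ≈ y → Big x → Big y
  big-resp q (x≉ε , x²≉ε) = (λ r → x≉ε (trans q r)) , (λ r → x²≉ε (involution-resp (sym q) r))

  big-⁻¹ : ∀ {x} → Big x → Big (x ⁻¹)
  big-⁻¹ (x≉ε , x²≉ε) =
    (λ r → x≉ε (inverse-trivial r)) ,
    (λ r → x²≉ε (involution-resp (⁻¹-involutive _) (involution-⁻¹ r)))

  big-swap : ∀ {x y} → Big (x ∙ y ⁻¹) → Big (y ∙ x ⁻¹)
  big-swap {x} {y} b = big-resp (quotient-⁻¹ x y) (big-⁻¹ b)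

  -- x y and y x are conjugate, so one is big iff the other is
  big-rotate : ∀ {x y} → Big (x ∙ y) → Big (y ∙ x)
  big-rotate {x} {y} (xy≉ε , xy²≉ε) = (λ r → xy≉ε (rotate-trivial r)) , (λ r → xy²≉ε (square r))
    where
      square : Involution (y ∙ x) → Involution (x ∙ y)
      square r = begin
        (x ∙ y) ∙ (x ∙ y) ≈⟨ sym (assoc _ _ _) ⟩
        ((x ∙ y) ∙ x) ∙ y ≈⟨ ∙-congʳ (assoc _ _ _) ⟩
        (x ∙ (y ∙ x)) ∙ y ≈⟨ rotate-trivial (trans (sym (assoc _ _ _)) r) ⟩
        ε ∎

  -- a central involution times a big element is big: (u y)² = y²
  big-central-involution : ∀ {u y} → Involution u → Commute u y → Big y → Big (u ∙ y)
  big-central-involution {u} {y} u² uy (y≉ε , y²≉ε) =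
    (λ r → y²≉ε (involution-resp (sym (inverseʳ-unique u y r)) (involution-⁻¹ u²))) ,
    (λ r → y²≉ε (trans (sym y²≈) r))
    where
      y²≈ : (u ∙ y) ∙ (u ∙ y) ≈ y ∙ y
      y²≈ = trans (interchange (sym uy)) (trans (∙-congʳ u²) (identityˡ _))

  pow-+ : ∀ x m k → pow G x (m + k) ≈ pow G x m ∙ pow G x k
  pow-+ x zero k = sym (identityˡ _)
  pow-+ x (suc m) k = trans (∙-congˡ (pow-+ x m k)) (sym (assoc _ _ _))

  pow¹ : ∀ x → pow G x 1 ≈ x
  pow¹ x = identityʳ x

  pow² : ∀ x → pow G x 2 ≈ x ∙ x
  pow² x = ∙-congˡ (identityʳ x)

  order2⇒ : ∀ {x} → Order2 G x → ¬ (x ≈ ε) × Involution x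
  order2⇒ {x} (_ , x²≈ε , minimal) =
    (λ r → minimal 1 (s≤s z≤n) (s≤s (s≤s z≤n)) (trans (pow¹ x) r)) , trans (sym (pow² x)) x²≈ε

  order2⇐ : ∀ {x} → ¬ (x ≈ ε) → Involution x → Order2 G x
  order2⇐ {x} x≉ε x² = s≤s z≤n , trans (pow² x) x² , minimal
    where
      minimal : ∀ k → 0 ℕ.< k → k ℕ.< 2 → ¬ pow G x k ≈ ε
      minimal (suc zero) _ _ r = x≉ε (trans (sym (pow¹ x)) r)
      minimal (suc (suc _)) _ (s≤s (s≤s ()))

  order2-resp : ∀ {x y} → x ≈ y → Order2 G x → Order2 G y
  order2-resp q o with order2⇒ o
  ... | x≉ε , x² = order2⇐ (λ r → x≉ε (trans q r)) (involution-resp q x²)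

  gt2⇒big : ∀ {x} → OrderGt2 G x → Big x
  gt2⇒big {x} (n , (_ , _ , minimal) , 2<n) =
    (λ r → minimal 1 (s≤s z≤n) (ℕP.<-trans (s≤s (s≤s z≤n)) 2<n) (trans (pow¹ x) r)) ,
    (λ r → minimal 2 (s≤s z≤n) 2<n (trans (pow² x) r))

  in₁ : ∀ {x S} → InSpan G (x ∷ S) x
  in₁ = gen (here P.refl)

  in₂ : ∀ {x y S} → InSpan G (y ∷ x ∷ S) x
  in₂ = gen (there (here P.refl))

  in₃ : ∀ {x y z S} → InSpan G (z ∷ y ∷ x ∷ S) x
  in₃ = gen (there (there (here P.refl)))

  uninvert : ∀ {S x} → InSpan G S (x ⁻¹) → InSpan G S x
  uninvert p = resp (⁻¹-involutive _) (inv p)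

  span-mono : ∀ {S T} → All (InSpan G T) S → ∀ {x} → InSpan G S x → InSpan G T x
  span-mono h (gen m) = All.lookup h m
  span-mono h one = one
  span-mono h (mul p q) = mul (span-mono h p) (span-mono h q)
  span-mono h (inv p) = inv (span-mono h p)
  span-mono h (resp q p) = resp q (span-mono h p)

  regenerate : ∀ {S T} → Generates G S → All (InSpan G T) S → Generates G T
  regenerate g h x = span-mono h (g x)

  commutes-with-span : ∀ {S z} → All (Commute z) S → ∀ {x} → InSpan G S x → Commute z x
  commutes-with-span h (gen m) = All.lookup h m
  commutes-with-span h one = commute-ε _
  commutes-with-span h (mul p q) = commute-∙ (commutes-with-span h p) (commutes-with-span h q)
  commutes-with-span h (inv p) = commute-⁻¹ (commutes-with-span h p)
  commutes-with-span h (resp q p) = commute-resp q (commutes-with-span h p)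

  abelian : ∀ {S} → Generates G S → All (λ s → All (Commute s) S) S → IsAbelian G
  abelian {S} g pairwise x y = commutes-with-span x-central (g y)
    where
      x-central : All (Commute x) S
      x-central = All.tabulate λ s∈S → sym (commutes-with-span (All.lookup pairwise s∈S) (g x))

  abelian-triple : ∀ {a b d} → GenTriple G a b d →
                   Commute a b → Commute b d → Commute a d → IsAbelian G
  abelian-triple g ab bd ad = abelian g
    ((refl ∷ ab ∷ ad ∷ []) ∷ (sym ab ∷ refl ∷ bd ∷ []) ∷ (sym ad ∷ sym bd ∷ refl ∷ []) ∷ [])

-- In a finite group everything the case analysis asks about is decidable.
module FiniteGroup {c ℓ} (G : Group c ℓ) (finite : IsFinite G) where
  open Group G
  open import Algebra.Properties.Group G
  open GroupFacts G

  N : ℕ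
  N = proj₁ finite

  enum : Fin N → Carrier
  enum = proj₁ (proj₂ finite)

  index : Carrier → Fin N
  index x = proj₁ (proj₁ (proj₂ (proj₂ finite)) x)

  enum-index : ∀ x → enum (index x) ≈ x
  enum-index x = proj₂ (proj₁ (proj₂ (proj₂ finite)) x)

  enum-injective : ∀ i j → enum i ≈ enum j → i ≡ j
  enum-injective = proj₂ (proj₂ (proj₂ finite))

  infix 4 _≈?_
  _≈?_ : ∀ x y → Dec (x ≈ y)
  x ≈? y with index x FP.≟ index y
  ... | yes i≡j = yes (trans (sym (enum-index x))
                        (trans (reflexive (P.cong enum i≡j)) (enum-index y)))
  ... | no i≢j = no λ q → i≢j (enum-injective _ _
                        (trans (enum-index x) (trans q (sym (enum-index y)))))

  -- by pigeonhole two of x⁰, …, x^N coincide, so some positive power is 1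
  some-power-trivial : ∀ x → ∃ λ d → 0 ℕ.< d × pow G x d ≈ ε
  some-power-trivial x with FP.pigeonhole (ℕP.n<1+n N) (λ (i : Fin (suc N)) → index (pow G x (toℕ i)))
  ... | i , j , i<j , same = toℕ j ∸ toℕ i , ℕP.m<n⇒0<n∸m i<j , ∙-cancelʳ (pow G x (toℕ i)) _ _ cancel
    where
      xⁱ≈xʲ : pow G x (toℕ i) ≈ pow G x (toℕ j)
      xⁱ≈xʲ = trans (sym (enum-index _)) (trans (reflexive (P.cong enum same)) (enum-index _))
      cancel : pow G x (toℕ j ∸ toℕ i) ∙ pow G x (toℕ i) ≈ ε ∙ pow G x (toℕ i)
      cancel = trans (sym (pow-+ x (toℕ j ∸ toℕ i) (toℕ i)))
                 (trans (reflexive (P.cong (pow G x) (ℕP.m∸n+n≡m (ℕP.<⇒≤ i<j))))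
                   (trans (sym xⁱ≈xʲ) (sym (identityˡ _))))

  order-exists : ∀ x → ∃ (HasOrder G x)
  order-exists x with some-power-trivial x
  ... | d , 0<d , xᵈ≈ε with leastWitness (λ k → (0 ℕP.<? k) ×-dec (pow G x k ≈? ε)) (0<d , xᵈ≈ε)
  ...   | n , (0<n , xⁿ≈ε) , least = n , 0<n , xⁿ≈ε , λ k 0<k k<n xᵏ≈ε → least k k<n (0<k , xᵏ≈ε)

  inverse-is-power : ∀ x → ∃ λ k → pow G x k ≈ x ⁻¹
  inverse-is-power x with some-power-trivial x
  ... | suc k , _ , xᵏ⁺¹≈ε = k , inverseʳ-unique x _ xᵏ⁺¹≈ε

  big⇒gt2 : ∀ {x} → Big x → OrderGt2 G x
  big⇒gt2 {x} (x≉ε , x²≉ε) with order-exists x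
  ... | suc zero , (_ , x¹≈ε , _) = ⊥-elim (x≉ε (trans (sym (pow¹ x)) x¹≈ε))
  ... | suc (suc zero) , (_ , x²≈ε , _) = ⊥-elim (x²≉ε (trans (sym (pow² x)) x²≈ε))
  ... | suc (suc (suc k)) , hasOrder = _ , hasOrder , s≤s (s≤s (s≤s z≤n))

  big? : ∀ x → Dec (Big x)
  big? x = ¬? (x ≈? ε) ×-dec ¬? ((x ∙ x) ≈? ε)

  order2? : ∀ x → Dec (Order2 G x)
  order2? x = map′ (uncurry order2⇐) order2⇒ (¬? (x ≈? ε) ×-dec ((x ∙ x) ≈? ε))

  involution-or-big : ∀ {u} → ¬ (u ≈ ε) → Order2 G u ⊎ Big u
  involution-or-big {u} u≉ε with (u ∙ u) ≈? ε
  ... | yes u² = inj₁ (order2⇐ u≉ε u²)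
  ... | no u²≉ε = inj₂ (u≉ε , u²≉ε)

  triple-search : ∀ {q} {Q : Carrier → Carrier → Carrier → Set q} →
    (∀ a b d → Dec (Q a b d)) →
    (∀ {a b d a′ b′ d′} → a ≈ a′ → b ≈ b′ → d ≈ d′ → Q a b d → Q a′ b′ d′) →
    (∃ λ a → ∃ λ b → ∃ λ d → Q a b d) ⊎ (∀ a b d → ¬ Q a b d)
  triple-search Q? Q-resp
    with FP.any? (λ i → FP.any? (λ j → FP.any? (λ k → Q? (enum i) (enum j) (enum k))))
  ... | yes (_ , _ , _ , q) = inj₁ (_ , _ , _ , q)
  ... | no none = inj₂ λ a b d q → none (index a , index b , index d ,
          Q-resp (sym (enum-index a)) (sym (enum-index b)) (sym (enum-index d)) q)

  -- Generation is decidable: the products of at most k generators increase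
  -- with k and stabilise; a stable level is closed under multiplication by
  -- the span, so it is the whole span.
  module Reachability (S : List Carrier) where

    Reach : ℕ → Carrier → Set ℓ
    Reach zero x = x ≈ ε
    Reach (suc k) x = Reach k x ⊎ ∃ λ (t : Fin (length S)) → Reach k (x ∙ lookup S t ⁻¹)

    reach? : ∀ k x → Dec (Reach k x)
    reach? zero x = x ≈? ε
    reach? (suc k) x = reach? k x ⊎-dec FP.any? (λ t → reach? k (x ∙ lookup S t ⁻¹))

    reach-resp : ∀ k {x y} → x ≈ y → Reach k x → Reach k y
    reach-resp zero q r = trans (sym q) r
    reach-resp (suc k) q (inj₁ r) = inj₁ (reach-resp k q r)
    reach-resp (suc k) q (inj₂ (t , r)) = inj₂ (t , reach-resp k (∙-congʳ q) r)

    reach-ε : ∀ k → Reach k ε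
    reach-ε zero = refl
    reach-ε (suc k) = inj₁ (reach-ε k)

    reach⇒span : ∀ k {x} → Reach k x → InSpan G S x
    reach⇒span zero r = resp (sym r) one
    reach⇒span (suc k) (inj₁ r) = reach⇒span k r
    reach⇒span (suc k) {x} (inj₂ (t , r)) =
      resp (//-rightDividesˡ _ x) (mul (reach⇒span k r) (gen (∈-lookup t)))

    open Stabilisation (λ k i → Reach k (enum i)) (λ k i → reach? k (enum i)) inj₁

    module _ {k} (stable : Stable k) where

      stable-everywhere : ∀ {x} → Reach (suc k) x → Reach k x
      stable-everywhere {x} r =
        reach-resp k (enum-index x) (stable (index x) (reach-resp (suc k) (sym (enum-index x)) r))

      ClosedUnder : Carrier → Set (c ⊔ ℓ)
      ClosedUnder x = ∀ {y} → Reach k y → Reach k (y ∙ x)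

      closed-pow : ∀ {x} → ClosedUnder x → ∀ m → ClosedUnder (pow G x m)
      closed-pow h zero r = reach-resp k (sym (identityʳ _)) r
      closed-pow h (suc m) r = reach-resp k (assoc _ _ _) (closed-pow h m (h r))

      closed : ∀ {x} → InSpan G S x → ClosedUnder x
      closed (gen s∈S) {y} r = stable-everywhere (inj₂ (Any.index s∈S , divide s∈S))
        where
          divide : ∀ {s} (s∈S : s ∈ S) → Reach k ((y ∙ s) ∙ lookup S (Any.index s∈S) ⁻¹)
          divide s∈S with lookup S (Any.index s∈S) | lookup-index s∈S
          ... | _ | P.refl = reach-resp k (sym (//-rightDividesʳ _ y)) r
      closed one r = reach-resp k (sym (identityʳ _)) r
      closed (mul p q) r = reach-resp k (assoc _ _ _) (closed q (closed p r))
      closed (inv {x} p) r with inverse-is-power x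
      ... | m , xᵐ≈x⁻¹ = reach-resp k (∙-congˡ xᵐ≈x⁻¹) (closed-pow (closed p) m r)
      closed (resp q p) r = reach-resp k (∙-congˡ q) (closed p r)

    generates? : Dec (Generates G S)
    generates? with stabilises
    ... | k , stable with FP.all? (λ i → reach? k (enum i))
    ...   | yes all = yes λ x → resp (enum-index x) (reach⇒span k (all (index x)))
    ...   | no ¬all = no λ g → ¬all λ i →
            reach-resp k (identityˡ _) (closed {k} stable (g (enum i)) (reach-ε k))

  open Reachability using (generates?) public

module RankThree {c ℓ} (G : Group c ℓ) (finite : IsFinite G) (rank : RankIs G 3) where
  open Group G
  open import Algebra.Properties.Group G
  open GroupFacts G
  open FiniteGroup G finite

  Outcome : Set (lsuc (c ⊔ ℓ))
  Outcome = GeneralizedDihedral G ⊎ Case2 G ⊎ Case3 G ⊎ Case4 G ⊎ Case5 G ⊎ Case6 G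

  ⟨ii⟩ : Case2 G → Outcome
  ⟨ii⟩ = inj₂ ∘ inj₁
  ⟨iii⟩ : Case3 G → Outcome
  ⟨iii⟩ = inj₂ ∘ inj₂ ∘ inj₁
  ⟨iv⟩ : Case4 G → Outcome
  ⟨iv⟩ = inj₂ ∘ inj₂ ∘ inj₂ ∘ inj₁
  ⟨v⟩ : Case5 G → Outcome
  ⟨v⟩ = inj₂ ∘ inj₂ ∘ inj₂ ∘ inj₂ ∘ inj₁
  ⟨vi⟩ : Case6 G → Outcome
  ⟨vi⟩ = inj₂ ∘ inj₂ ∘ inj₂ ∘ inj₂ ∘ inj₂

  -- the only use of d(G) = 3
  no-two-generators : ∀ {y z} → ¬ Generates G (y ∷ z ∷ [])
  no-two-generators = proj₂ rank _ (s≤s (s≤s (s≤s z≤n)))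

  -- in a generating triple x ≠ y and x ≠ y⁻¹, else {y, z} would generate
  quotient-nontrivial : ∀ {x y z} → GenTriple G x y z → ¬ (x ∙ y ⁻¹ ≈ ε)
  quotient-nontrivial g q =
    no-two-generators (regenerate g (resp (sym (x∙y⁻¹≈ε⇒x≈y _ _ q)) in₁ ∷ in₁ ∷ in₂ ∷ []))

  product-nontrivial : ∀ {x y z} → GenTriple G x y z → ¬ (x ∙ y ≈ ε)
  product-nontrivial g q =
    no-two-generators (regenerate g (resp (sym (inverseˡ-unique _ _ q)) (inv in₁) ∷ in₁ ∷ in₂ ∷ []))

  Admissible : Carrier → Carrier → Carrier → Set (c ⊔ ℓ)
  Admissible a b d = GenTriple G a b d × Big a × Big b × Big d

  quotient-kind : ∀ {x y z} → Admissible x y z → Order2 G (x ∙ y ⁻¹) ⊎ Big (x ∙ y ⁻¹)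
  quotient-kind (g , _) = involution-or-big (quotient-nontrivial g)

  product-kind : ∀ {x y z} → Admissible x y z → Order2 G (x ∙ y) ⊎ Big (x ∙ y)
  product-kind (g , _) = involution-or-big (product-nontrivial g)

  swap₁₂ : ∀ {a b d} → Admissible a b d → Admissible b a d
  swap₁₂ (g , ba , bb , bd) = regenerate g (in₂ ∷ in₁ ∷ in₃ ∷ []) , bb , ba , bd

  swap₂₃ : ∀ {a b d} → Admissible a b d → Admissible a d b
  swap₂₃ (g , ba , bb , bd) = regenerate g (in₁ ∷ in₃ ∷ in₂ ∷ []) , ba , bd , bb

  rotate : ∀ {a b d} → Admissible a b d → Admissible b d a
  rotate adm = swap₂₃ (swap₁₂ adm)

  reverse : ∀ {a b d} → Admissible a b d → Admissible d b a
  reverse adm = swap₁₂ (rotate adm)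

  invert₁ : ∀ {a b d} → Admissible a b d → Admissible (a ⁻¹) b d
  invert₁ (g , ba , bb , bd) = regenerate g (uninvert in₁ ∷ in₂ ∷ in₃ ∷ []) , big-⁻¹ ba , bb , bd

  invert₂ : ∀ {a b d} → Admissible a b d → Admissible a (b ⁻¹) d
  invert₂ (g , ba , bb , bd) = regenerate g (in₁ ∷ uninvert in₂ ∷ in₃ ∷ []) , ba , big-⁻¹ bb , bd

  invert₃ : ∀ {a b d} → Admissible a b d → Admissible a b (d ⁻¹)
  invert₃ (g , ba , bb , bd) = regenerate g (in₁ ∷ in₂ ∷ uninvert in₃ ∷ []) , ba , bb , big-⁻¹ bd

  SixInvolutions : Carrier → Carrier → Carrier → Set ℓ
  SixInvolutions a b d = Order2 G (a ∙ b) × Order2 G (a ∙ b ⁻¹) × Order2 G (b ∙ d) ×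
                         Order2 G (b ∙ d ⁻¹) × Order2 G (a ∙ d) × Order2 G (a ∙ d ⁻¹)

  -- admissible triples with one, resp. two, big consecutive quotients;
  -- Chain₂ is the common hypothesis of (ii) and (vi)
  Chain₁ : Carrier → Carrier → Carrier → Set (c ⊔ ℓ)
  Chain₁ a b d = Admissible a b d × Big (b ∙ a ⁻¹)

  Chain₂ : Carrier → Carrier → Carrier → Set (c ⊔ ℓ)
  Chain₂ a b d = Chain₁ a b d × Big (d ∙ b ⁻¹)

  case-vi : ∀ {a b d} → Chain₂ a b d → ¬ Commute a b → Outcome
  case-vi (((g , ba , bb , bd) , bba) , bdb) ¬ab =
    ⟨vi⟩ (_ , _ , _ , g , big⇒gt2 ba , big⇒gt2 bb , big⇒gt2 bd , big⇒gt2 bba , big⇒gt2 bdb ,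
          ¬ab ∘ commutator-trivial)

  case-iv-or-v : ∀ {a b d} → Case45Core G a b d → Outcome
  case-iv-or-v {a} {b} {d} core with comm G a d ≈? ε
  ... | yes [a,d]≈ε = ⟨v⟩ (a , b , d , core , [a,d]≈ε)
  ... | no [a,d]≉ε = ⟨iv⟩ (a , b , d , core , [a,d]≉ε)

  -- If y commutes with x and z, x and z do not, and x z⁻¹ is an involution,
  -- then z y is an involution, or (vi) holds for the triple (x, zy, y):
  -- there (zy) x⁻¹ = (z x⁻¹) y is a central involution times a big element.
  zy-involution-or-vi : ∀ {x y z} → Admissible x y z → Commute x y → Commute z y →
    ¬ Commute x z → Involution (x ∙ z ⁻¹) → Outcome ⊎ Involution (z ∙ y)
  zy-involution-or-vi {x} {y} {z} adm@(g , bx , by , bz) xy zy ¬xz xz⁻¹² with (z ∙ y) ∙ (z ∙ y) ≈? ε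
  ... | yes zy² = inj₂ zy²
  ... | no ¬zy² = inj₁ (case-vi (((g′ , bx , bzy , by) , bzyx⁻¹) , by[zy]⁻¹) ¬x[zy])
    where
      g′ : GenTriple G x (z ∙ y) y
      g′ = regenerate g (in₁ ∷ in₃ ∷ resp (//-rightDividesʳ y z) (mul in₂ (inv in₃)) ∷ [])
      bzy : Big (z ∙ y)
      bzy = product-nontrivial (proj₁ (reverse adm)) , ¬zy²
      y-zx⁻¹ : Commute y (z ∙ x ⁻¹)
      y-zx⁻¹ = commute-∙ (sym zy) (commute-⁻¹ (sym xy))
      bzyx⁻¹ : Big ((z ∙ y) ∙ x ⁻¹)
      bzyx⁻¹ = big-resp (trans (assoc _ _ _) (trans (∙-congˡ (sym (commute-⁻¹ (sym xy))))
                                                    (sym (assoc _ _ _))))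
                 (big-central-involution (involution-swap xz⁻¹²) (sym y-zx⁻¹) by)
      by[zy]⁻¹ : Big (y ∙ (z ∙ y) ⁻¹)
      by[zy]⁻¹ = big-resp (sym (trans (∙-congˡ (⁻¹-anti-homo-∙ z y)) (\\-leftDividesˡ y _)))
                   (big-⁻¹ bz)
      ¬x[zy] : ¬ Commute x (z ∙ y)
      ¬x[zy] q = ¬xz (commute-resp (//-rightDividesʳ y z) (commute-∙ q (commute-⁻¹ xy)))

  -- When b commutes with a and c but a and c do not, and a c, a c⁻¹ are
  -- involutions, (vi) must hold: otherwise cb, ab and ab⁻¹ are involutions,
  -- and then a and c commute after all.
  forced-vi : ∀ {a b c} → Admissible a b c → Commute a b → Commute c b → ¬ Commute a c →
              Involution (a ∙ c ⁻¹) → Involution (a ∙ c) → Outcome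
  forced-vi adm ab cb ¬ac ac⁻¹² ac² with zy-involution-or-vi adm ab cb ¬ac ac⁻¹²
  ... | inj₁ out = out
  ... | inj₂ cb² with zy-involution-or-vi (reverse adm) cb ab (¬ac ∘ sym) (involution-swap ac⁻¹²)
  ...   | inj₁ out = out
  ...   | inj₂ ab² with zy-involution-or-vi (invert₂ (reverse adm)) (commute-⁻¹ cb) (commute-⁻¹ ab)
                          (¬ac ∘ sym) (involution-swap ac⁻¹²)
  ...     | inj₁ out = out
  ...     | inj₂ ab⁻¹² = ⊥-elim (¬ac (commute-from-involutions ab cb ab² ab⁻¹² cb² ac²))

  -- From a Chain₂ (a, b, c): noncommuting neighbours give (vi), commuting
  -- generators give (ii); otherwise a, c do not commute and (vi) arises from
  -- a big a c^{±1} or from forced-vi.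
  chain₂-outcome : ∀ {a b c} → Chain₂ a b c → Outcome
  chain₂-outcome {a} {b} {c} ch@((adm@(g , ba , bb , bc) , bba) , bcb) with (a ∙ b) ≈? (b ∙ a)
  ... | no ¬ab = case-vi ch ¬ab
  ... | yes ab with (c ∙ b) ≈? (b ∙ c)
  ...   | no ¬cb = case-vi ((reverse adm , big-swap bcb) , big-swap bba) ¬cb
  ...   | yes cb with (a ∙ c) ≈? (c ∙ a)
  ...     | yes ac = ⟨ii⟩ (abelian-triple g ab (sym cb) ac , a , b , c , g ,
                          big⇒gt2 ba , big⇒gt2 bb , big⇒gt2 bc , big⇒gt2 bba , big⇒gt2 bcb)
  ...     | no ¬ac with quotient-kind (swap₂₃ adm) | product-kind (swap₂₃ adm)
  ...       | inj₂ bac⁻¹ | _ = case-vi ((rotate (rotate adm) , bac⁻¹) , bba) (¬ac ∘ sym)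
  ...       | inj₁ _ | inj₂ bac =
                case-vi ((invert₁ (rotate (rotate adm)) , big-resp (∙-congˡ (sym (⁻¹-involutive c))) bac) , bba)
                        (λ q → ¬ac (commute-resp (⁻¹-involutive c) (commute-⁻¹ (sym q))))
  ...       | inj₁ o₁ | inj₁ o₂ = forced-vi adm ab cb ¬ac (proj₂ (order2⇒ o₁)) (proj₂ (order2⇒ o₂))

  -- From a Chain₁ (a, b, c): a big b c^{±1} or c a^{±1} extends it to a
  -- Chain₂; if all four are involutions we are in (iv) or (v) for (b, c, a).
  chain₁-outcome : ∀ {a b c} → Chain₁ a b c → Outcome
  chain₁-outcome {a} {b} {c} ch@(adm , bba) with quotient-kind (rotate adm) | product-kind (rotate adm)
  ... | inj₂ bbc⁻¹ | _ = chain₂-outcome (ch , big-swap bbc⁻¹)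
  ... | inj₁ _ | inj₂ bbc = chain₂-outcome ((invert₃ adm , bba) , big-resp (⁻¹-anti-homo-∙ b c) (big-⁻¹ bbc))
  ... | inj₁ o₁ | inj₁ o₂ with quotient-kind (rotate (rotate adm)) | product-kind (rotate (rotate adm))
  ...   | inj₂ bca⁻¹ | _ = chain₂-outcome ((swap₁₂ adm , big-swap bba) , bca⁻¹)
  ...   | inj₁ _ | inj₂ bca = chain₂-outcome ((invert₃ (swap₁₂ adm) , big-swap bba) ,
                                 big-resp (⁻¹-anti-homo-∙ a c) (big-⁻¹ (big-rotate bca)))
  ...   | inj₁ o₃ | inj₁ o₄ with rotate adm
  ...     | (g , bb , bc , ba) =
                case-iv-or-v (g , big⇒gt2 bb , big⇒gt2 bc , big⇒gt2 ba , o₂ , o₁ , o₄ , o₃ , big⇒gt2 bba)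

  -- a big x y gives the Chain₁ (x, y⁻¹, z), as y⁻¹ x⁻¹ = (x y)⁻¹
  from-product : ∀ {x y z} → Admissible x y z → Big (x ∙ y) → Chain₁ x (y ⁻¹) z
  from-product {x} {y} adm big = invert₂ adm , big-resp (⁻¹-anti-homo-∙ x y) (big-⁻¹ big)

  -- A bad triple: some product of (iii) is big, which yields a Chain₁.
  bad-outcome : ∀ {a b d} → Admissible a b d → ¬ SixInvolutions a b d → Outcome
  bad-outcome {a} {b} {d} adm ¬six
    with product-kind adm | quotient-kind adm | product-kind (rotate adm)
       | quotient-kind (rotate adm) | product-kind (swap₂₃ adm) | quotient-kind (swap₂₃ adm)
  ... | inj₂ big | _ | _ | _ | _ | _ = chain₁-outcome (from-product adm big)
  ... | inj₁ _ | inj₂ big | _ | _ | _ | _ = chain₁-outcome (adm , big-swap big)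
  ... | inj₁ _ | inj₁ _ | inj₂ big | _ | _ | _ = chain₁-outcome (from-product (rotate adm) big)
  ... | inj₁ _ | inj₁ _ | inj₁ _ | inj₂ big | _ | _ = chain₁-outcome (rotate adm , big-swap big)
  ... | inj₁ _ | inj₁ _ | inj₁ _ | inj₁ _ | inj₂ big | _ = chain₁-outcome (from-product (swap₂₃ adm) big)
  ... | inj₁ _ | inj₁ _ | inj₁ _ | inj₁ _ | inj₁ _ | inj₂ big = chain₁-outcome (swap₂₃ adm , big-swap big)
  ... | inj₁ o₁ | inj₁ o₂ | inj₁ o₃ | inj₁ o₄ | inj₁ o₅ | inj₁ o₆ = ⊥-elim (¬six (o₁ , o₂ , o₃ , o₄ , o₅ , o₆))

  six? : ∀ a b d → Dec (SixInvolutions a b d)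
  six? a b d = order2? _ ×-dec order2? _ ×-dec order2? _ ×-dec order2? _ ×-dec order2? _ ×-dec order2? _

  Bad : Carrier → Carrier → Carrier → Set (c ⊔ ℓ)
  Bad a b d = Admissible a b d × ¬ SixInvolutions a b d

  bad? : ∀ a b d → Dec (Bad a b d)
  bad? a b d = (generates? (a ∷ b ∷ d ∷ []) ×-dec big? a ×-dec big? b ×-dec big? d) ×-dec ¬? (six? a b d)

  bad-resp : ∀ {a b d a′ b′ d′} → a ≈ a′ → b ≈ b′ → d ≈ d′ → Bad a b d → Bad a′ b′ d′
  bad-resp qa qb qd ((g , ba , bb , bd) , ¬six) =
    (regenerate g (resp (sym qa) in₁ ∷ resp (sym qb) in₂ ∷ resp (sym qd) in₃ ∷ []) ,
     big-resp qa ba , big-resp qb bb , big-resp qd bd) ,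
    λ (o₁ , o₂ , o₃ , o₄ , o₅ , o₆) → ¬six
      (order2-resp (∙-cong (sym qa) (sym qb)) o₁ , order2-resp (∙-cong (sym qa) (⁻¹-cong (sym qb))) o₂ ,
       order2-resp (∙-cong (sym qb) (sym qd)) o₃ , order2-resp (∙-cong (sym qb) (⁻¹-cong (sym qd))) o₄ ,
       order2-resp (∙-cong (sym qa) (sym qd)) o₅ , order2-resp (∙-cong (sym qa) (⁻¹-cong (sym qd))) o₆)

  theorem : Outcome
  theorem with triple-search bad? bad-resp
  ... | inj₁ (_ , _ , _ , adm , ¬six) = bad-outcome adm ¬six
  ... | inj₂ none = ⟨iii⟩ λ a b d g oa ob od → decidable-stable (six? a b d) λ ¬six →
          none a b d ((g , gt2⇒big oa , gt2⇒big ob , gt2⇒big od) , ¬six)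

lemma4p1 : {c ℓ : Level} (G : Group c ℓ) → IsFinite G → RankIs G 3 →
    GeneralizedDihedral G ⊎ Case2 G ⊎ Case3 G ⊎ Case4 G ⊎ Case5 G ⊎ Case6 G
lemma4p1 G finite rank = RankThree.theorem G finite rank
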